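{- For any $k$ and any $N\in \mathbb N^*$, $\mathfrak m_k (N)$ is finite. More precisely, we have the bound: $$ \mathfrak m_k (N) \leq k^{N-1}\,. $$
   Context: For $N\in\mathbb N^*=\mathbb N\setminus\{0\}$, let $\mathfrak M(N)$ be the family of arrays $\mathfrak A=(a^n_i)$ with $N$ rows $n=1,\dots,N$, each row being an infinite sequence of real numbers with $a^n_i<a^n_{i+1}$. The spectrum of $\mathfrak A$ is the set of all sums $\lambda=\sum_{n=1}^N a^n_{j_n}$ with $(j_1,\dots,j_N)\in(\mathbb N^*)^N$; the multiplicity $m(\lambda)$ of $\lambda$ is the (finite) number of such $N$-tuples representing it. Ordering the spectrum as a non-decreasing sequence $\lambda_1(\mathfrak A)\le\lambda_2(\mathfrak A)\le\dots$ counted with multiplicity, set $m(k,\mathfrak A)=m(\lambda_k(\mathfrak A))$ and $\mathfrak m_k(N)=\sup_{\mathfrak A\in\mathfrak M(N)} m(k,\mathfrak A)\in\mathbb N^*\cup\{+\infty\}$. -}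

module Defs where

open import Level using (0ℓ)
open import Data.Nat as ℕ using (ℕ; suc)
open import Data.Fin using (Fin; zero; suc)
open import Data.Vec using (Vec; lookup)
open import Data.List using (List; length)
open import Data.List.Relation.Unary.All using (All)
open import Data.List.Relation.Unary.Unique.Propositional using (Unique)
open import Data.Product using (Σ; _×_)
open import Data.Sum using (_⊎_)
open import Relation.Nullary using (¬_)
open import Relation.Binary.PropositionalEquality using (_≡_)
open import Relation.Binary.Structures using (IsStrictTotalOrder)
open import Algebra.Structures using (IsCommutativeRing)

-- An axiomatisation of the real numbers: a Dedekind-complete
-- totally ordered field (unique up to isomorphism, classically).
record RealNumbers : Set₁ where
  infixl 6 _+_
  infixl 7 _*_
  infix  4 _<_ _≤_
  field
    ℝ   : Set
    _+_ : ℝ → ℝ → ℝ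
    _*_ : ℝ → ℝ → ℝ
    -_  : ℝ → ℝ
    0r  : ℝ
    1r  : ℝ
    isCommutativeRing : IsCommutativeRing _≡_ _+_ _*_ -_ 0r 1r
    0≢1     : ¬ (0r ≡ 1r)
    inverse : ∀ a → ¬ (a ≡ 0r) → Σ ℝ (λ b → a * b ≡ 1r)
    _<_ : ℝ → ℝ → Set
    <-isStrictTotalOrder : IsStrictTotalOrder _≡_ _<_
    +-mono-< : ∀ {a b} c → a < b → a + c < b + c
    *-pos    : ∀ {a b} → 0r < a → 0r < b → 0r < a * b

  _≤_ : ℝ → ℝ → Set
  a ≤ b = a < b ⊎ a ≡ b

  IsUpperBound : (ℝ → Set) → ℝ → Set
  IsUpperBound P u = ∀ x → P x → x ≤ u

  IsLeastUpperBound : (ℝ → Set) → ℝ → Set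
  IsLeastUpperBound P s = IsUpperBound P s × (∀ u → IsUpperBound P u → s ≤ u)

  field
    complete : (P : ℝ → Set) → Σ ℝ P → Σ ℝ (IsUpperBound P) →
               Σ ℝ (IsLeastUpperBound P)

module Spectrum (R : RealNumbers) where
  open RealNumbers R

  sumFin : ∀ {N} → (Fin N → ℝ) → ℝ
  sumFin {ℕ.zero} f = 0r
  sumFin {suc N} f = f zero + sumFin (λ n → f (suc n))

  -- an array with N rows, each an infinite sequence (indexed from 0)
  Array : ℕ → Set
  Array N = Fin N → ℕ → ℝ

  InM : ∀ {N} → Array N → Set
  InM a = ∀ n i → a n i < a n (suc i)

  -- index tuples (j₁,…,j_N), 0-based
  Tuple : ℕ → Set
  Tuple N = Vec ℕ N

  tupleSum : ∀ {N} → Array N → Tuple N → ℝ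
  tupleSum a j = sumFin (λ n → a n (lookup j n))

  -- λ is λ_k(𝔄): fewer than k tuples (with multiplicity) have sum < λ,
  -- and at least k tuples have sum ≤ λ.
  IsKthEigenvalue : ∀ {N} → Array N → ℕ → ℝ → Set
  IsKthEigenvalue {N} a k λ′ =
    (∀ (ts : List (Tuple N)) → Unique ts →
       All (λ t → tupleSum a t < λ′) ts → length ts ℕ.< k)
    × Σ (List (Tuple N)) (λ ts → Unique ts ×
         All (λ t → tupleSum a t ≤ λ′) ts × k ℕ.≤ length ts)

module Submission where

-- A tuple with sum λ_k is determined by its last N − 1 indices, because the first row is
-- strictly increasing. Each index j of such a tuple is below k: lowering it to 0, …, j − 1
-- gives j distinct tuples with sum < λ_k, and there are fewer than k of those. So the tuples
-- with sum λ_k inject into {0, …, k − 1}^(N−1).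

open import Defs
open import Data.Nat using (ℕ; suc; _≤_; _^_)
open import Data.List using (List; length)
open import Data.List.Relation.Unary.All using (All)
open import Data.List.Relation.Unary.Unique.Propositional using (Unique)
open import Relation.Binary.PropositionalEquality using (_≡_)

open import Data.Nat using (zero; _+_; _<_; _*_; z≤n; s≤s)
open import Data.Nat.Properties using (m≤n⇒m<n∨m≡n; <-cmp; module ≤-Reasoning)
open import Data.Fin as Fin using (Fin)
open import Data.Fin.Properties using (suc-injective)
open import Data.Vec as Vec using (Vec; lookup; _[_]≔_)
open import Data.Vec.Properties using (lookup∘update; lookup∘update′)
open import Data.List using ([]; _∷_; map; _++_; upTo; cartesianProductWith)
open import Data.List.Properties using (length-map; length-++; length-upTo; length-removeAt′)
open import Data.List.Membership.Propositional using (_∈_; _─_)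
open import Data.List.Membership.Propositional.Properties
  using (∈-map⁻; ∈-upTo⁺; ∈-cartesianProductWith⁺)
open import Data.List.Relation.Binary.Subset.Propositional using (_⊆_)
open import Data.List.Relation.Unary.Any using (here; there; index)
open import Data.List.Relation.Unary.AllPairs using ([]; _∷_)
import Data.List.Relation.Unary.All as All
import Data.List.Relation.Unary.All.Properties as All
import Data.List.Relation.Unary.Unique.Propositional.Properties as Unique
open import Data.Sum using (inj₁; inj₂)
open import Data.Product using (_,_)
open import Data.Empty using (⊥-elim)
open import Function using (_∘_)
open import Relation.Binary.PropositionalEquality
  using (refl; sym; trans; cong; cong₂; subst; subst₂; _≢_; ≢-sym; module ≡-Reasoning)
open import Relation.Binary.Definitions using (tri<; tri≈; tri>)
open import Algebra.Structures using (IsCommutativeRing)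
open import Relation.Binary.Structures using (IsStrictTotalOrder)

module _ {A : Set} where

  ∈-─⁺ : ∀ {x y : A} {ys} → y ∈ ys → (p : x ∈ ys) → y ≢ x → y ∈ ys ─ p
  ∈-─⁺ (here refl) (here refl) y≢x = ⊥-elim (y≢x refl)
  ∈-─⁺ (here eq)   (there p)   y≢x = here eq
  ∈-─⁺ (there q)   (here refl) y≢x = q
  ∈-─⁺ (there q)   (there p)   y≢x = there (∈-─⁺ q p y≢x)

  unique⊆⇒length≤ : ∀ {xs ys : List A} → Unique xs → xs ⊆ ys → length xs ≤ length ys
  unique⊆⇒length≤ {[]}     _             _  = z≤n
  unique⊆⇒length≤ {x ∷ xs} {ys} (x∉xs ∷ u) xs⊆ys =
    subst (suc (length xs) ≤_) (sym (length-removeAt′ ys (index x∈ys)))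
      (s≤s (unique⊆⇒length≤ u λ y∈xs →
        ∈-─⁺ (xs⊆ys (there y∈xs)) x∈ys (≢-sym (All.lookup x∉xs y∈xs))))
    where
    x∈ys : x ∈ ys
    x∈ys = xs⊆ys (here refl)

module _ {A B : Set} (f : A → B) where

  Unique-map⁺ : ∀ {xs} → (∀ {x y} → x ∈ xs → y ∈ xs → f x ≡ f y → x ≡ y) →
                Unique xs → Unique (map f xs)
  Unique-map⁺ {[]}     inj []           = []
  Unique-map⁺ {x ∷ xs} inj (x∉xs ∷ u) =
    All.map⁺ (All.tabulate λ y∈xs fx≡fy →
                All.lookup x∉xs y∈xs (inj (here refl) (there y∈xs) fx≡fy))
    ∷ Unique-map⁺ (λ x∈ y∈ → inj (there x∈) (there y∈)) u

module _ {A B C : Set} (f : A → B → C) where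

  length-cartesianProductWith : ∀ xs ys →
    length (cartesianProductWith f xs ys) ≡ length xs * length ys
  length-cartesianProductWith []       ys = refl
  length-cartesianProductWith (x ∷ xs) ys = begin
    length (map (f x) ys ++ cartesianProductWith f xs ys)
      ≡⟨ length-++ (map (f x) ys) ⟩
    length (map (f x) ys) + length (cartesianProductWith f xs ys)
      ≡⟨ cong₂ _+_ (length-map (f x) ys) (length-cartesianProductWith xs ys) ⟩
    length ys + length xs * length ys ∎
    where open ≡-Reasoning

boundedVecs : ℕ → (M : ℕ) → List (Vec ℕ M)
boundedVecs k zero    = Vec.[] ∷ []
boundedVecs k (suc M) = cartesianProductWith Vec._∷_ (upTo k) (boundedVecs k M)

length-boundedVecs : ∀ k M → length (boundedVecs k M) ≡ k ^ M
length-boundedVecs k zero    = refl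
length-boundedVecs k (suc M) = begin
  length (cartesianProductWith Vec._∷_ (upTo k) (boundedVecs k M))
    ≡⟨ length-cartesianProductWith Vec._∷_ (upTo k) (boundedVecs k M) ⟩
  length (upTo k) * length (boundedVecs k M)
    ≡⟨ cong₂ _*_ (length-upTo k) (length-boundedVecs k M) ⟩
  k * k ^ M ∎
  where open ≡-Reasoning

∈-boundedVecs⁺ : ∀ {k M} (v : Vec ℕ M) → (∀ n → lookup v n < k) → v ∈ boundedVecs k M
∈-boundedVecs⁺ Vec.[]       _ = here refl
∈-boundedVecs⁺ (i Vec.∷ v) v<k = ∈-cartesianProductWith⁺ Vec._∷_
  (∈-upTo⁺ (v<k Fin.zero)) (∈-boundedVecs⁺ v (v<k ∘ Fin.suc))

module _ (R : RealNumbers) where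
  open RealNumbers R renaming (_+_ to _+ᵣ_; _<_ to _<ᵣ_; _≤_ to _≤ᵣ_)
  open Spectrum R
  open IsCommutativeRing isCommutativeRing using (+-comm)
  open IsStrictTotalOrder <-isStrictTotalOrder renaming (trans to <-trans) using (irrefl)

  +-monoʳ-< : ∀ c {x y} → x <ᵣ y → c +ᵣ x <ᵣ c +ᵣ y
  +-monoʳ-< c {x} {y} x<y = subst₂ _<ᵣ_ (+-comm x c) (+-comm y c) (+-mono-< c x<y)

  <-≤-trans : ∀ {x y z} → x <ᵣ y → y ≤ᵣ z → x <ᵣ z
  <-≤-trans x<y (inj₁ y<z)  = <-trans x<y y<z
  <-≤-trans x<y (inj₂ refl) = x<y

  sumFin-cong : ∀ {N} {f g : Fin N → ℝ} → (∀ n → f n ≡ g n) → sumFin f ≡ sumFin g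
  sumFin-cong {zero}  _   = refl
  sumFin-cong {suc N} f≗g = cong₂ _+ᵣ_ (f≗g Fin.zero) (sumFin-cong (f≗g ∘ Fin.suc))

  sumFin-<-at : ∀ {N} {f g : Fin N → ℝ} n → f n <ᵣ g n → (∀ m → m ≢ n → f m ≡ g m) →
                sumFin f <ᵣ sumFin g
  sumFin-<-at {f = f} {g} Fin.zero f0<g0 rest =
    subst (λ s → f Fin.zero +ᵣ sumFin (f ∘ Fin.suc) <ᵣ g Fin.zero +ᵣ s)
      (sumFin-cong λ m → rest (Fin.suc m) λ ())
      (+-mono-< _ f0<g0)
  sumFin-<-at {f = f} {g} (Fin.suc n) fn<gn rest =
    subst (λ x → f Fin.zero +ᵣ sumFin (f ∘ Fin.suc) <ᵣ x +ᵣ sumFin (g ∘ Fin.suc))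
      (rest Fin.zero λ ())
      (+-monoʳ-< (f Fin.zero)
        (sumFin-<-at n fn<gn λ m m≢n → rest (Fin.suc m) (m≢n ∘ suc-injective)))

  module _ {N} {a : Array N} (inM : InM a) where

    row-mono-< : ∀ n {i j} → i < j → a n i <ᵣ a n j
    row-mono-< n {j = suc j} (s≤s i≤j) with m≤n⇒m<n∨m≡n i≤j
    ... | inj₁ i<j  = <-trans (row-mono-< n i<j) (inM n j)
    ... | inj₂ refl = inM n j

    tupleSum-lower-< : ∀ t n {i} → i < lookup t n → tupleSum a (t [ n ]≔ i) <ᵣ tupleSum a t
    tupleSum-lower-< t n {i} i<tₙ = sumFin-<-at n
      (subst (λ j → a n j <ᵣ a n (lookup t n)) (sym (lookup∘update n t i)) (row-mono-< n i<tₙ))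
      (λ m m≢n → cong (a m) (lookup∘update′ m≢n t i))

    lookup<k : ∀ {k λ′} → IsKthEigenvalue a k λ′ →
               ∀ t → tupleSum a t ≤ᵣ λ′ → ∀ n → lookup t n < k
    lookup<k {k} {λ′} (fewer-below , _) t t≤λ n =
      subst (_< k) (trans (length-map (t [ n ]≔_) (upTo tₙ)) (length-upTo tₙ))
        (fewer-below (map (t [ n ]≔_) (upTo tₙ))
          (Unique.map⁺ update-injective (Unique.upTo⁺ tₙ))
          (All.map⁺ (All.map below-λ (All.all-upTo tₙ))))
      where
      tₙ : ℕ
      tₙ = lookup t n
      below-λ : ∀ {i} → i < tₙ → tupleSum a (t [ n ]≔ i) <ᵣ λ′
      below-λ i<tₙ = <-≤-trans (tupleSum-lower-< t n i<tₙ) t≤λ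
      update-injective : ∀ {i j} → t [ n ]≔ i ≡ t [ n ]≔ j → i ≡ j
      update-injective {i} {j} eq =
        trans (sym (lookup∘update n t i)) (trans (cong (λ s → lookup s n) eq) (lookup∘update n t j))

  tupleSum-tail-injective : ∀ {M} {a : Array (suc M)} → InM a → ∀ {s t : Tuple (suc M)} →
    tupleSum a s ≡ tupleSum a t → Vec.tail s ≡ Vec.tail t → s ≡ t
  tupleSum-tail-injective inM {i Vec.∷ js} {j Vec.∷ .js} eq refl with <-cmp i j
  ... | tri≈ _ refl _ = refl
  ... | tri< i<j _ _ = ⊥-elim (irrefl eq (+-mono-< _ (row-mono-< inM Fin.zero i<j)))
  ... | tri> _ _ j<i = ⊥-elim (irrefl (sym eq) (+-mono-< _ (row-mono-< inM Fin.zero j<i)))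

proposition1p2 : (R : RealNumbers) → (k M : ℕ) →
    (a : Spectrum.Array R (suc M)) → Spectrum.InM R a →
    (λk : RealNumbers.ℝ R) → Spectrum.IsKthEigenvalue R a k λk →
    (ts : List (Spectrum.Tuple R (suc M))) → Unique ts →
    All (λ t → Spectrum.tupleSum R a t ≡ λk) ts →
    length ts ≤ k ^ M
proposition1p2 R k M a inM λk isKth ts unique-ts sums≡λk = begin
  length ts                 ≡⟨ length-map Vec.tail ts ⟨
  length (map Vec.tail ts)  ≤⟨ unique⊆⇒length≤ unique-tails tails-bounded ⟩
  length (boundedVecs k M)  ≡⟨ length-boundedVecs k M ⟩
  k ^ M                     ∎
  where
  open ≤-Reasoning
  sum≡λk : ∀ {t} → t ∈ ts → Spectrum.tupleSum R a t ≡ λk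
  sum≡λk = All.lookup sums≡λk
  tail-injective : ∀ {s t} → s ∈ ts → t ∈ ts → Vec.tail s ≡ Vec.tail t → s ≡ t
  tail-injective s∈ts t∈ts =
    tupleSum-tail-injective R inM (trans (sum≡λk s∈ts) (sym (sum≡λk t∈ts)))
  unique-tails : Unique (map Vec.tail ts)
  unique-tails = Unique-map⁺ Vec.tail tail-injective unique-ts
  tails-bounded : map Vec.tail ts ⊆ boundedVecs k M
  tails-bounded v∈ with ∈-map⁻ Vec.tail v∈
  ... | j Vec.∷ js , t∈ts , refl =
    ∈-boundedVecs⁺ js λ n → lookup<k R inM isKth (j Vec.∷ js) (inj₂ (sum≡λk t∈ts)) (Fin.suc n)
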